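{- Consider the unbiased Waiter-Client game played on the edges of a complete graph, where in each round Waiter offers two yet unclaimed edges, Client chooses one of them to be coloured red (added to Client's graph), and the other is coloured blue (added to Waiter's graph). Let $l \geq 2$ and let $v_1,v_2,\dots,v_{2^l-1}$ be $2^l-1$ vertices such that no edge among them has been claimed yet. Then, whatever Client does, Waiter can, in at most $2^l$ rounds in which she only offers edges with both endpoints in $\{v_1,\dots,v_{2^l-1}\}$, create a red clique on vertices $w_1,\dots,w_l$ with $w_1=v_1$, such that moreover every edge claimed during these rounds (red or blue) has at least one endpoint in $\{w_1,\dots,w_l\}$. -}

module Defs where

open import Data.Nat using (ℕ; zero; suc)
open import Data.Fin using (Fin; toℕ)
open import Data.Product using (_×_; _,_; ∃; proj₁; proj₂)
open import Data.Sum using (_⊎_)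
open import Data.List using (List; []; _∷_; _++_)
open import Data.List.Relation.Unary.Any using (Any)
open import Data.List.Membership.Propositional using (_∈_)
open import Relation.Binary.PropositionalEquality using (_≡_; _≢_)
open import Relation.Nullary using (¬_)

-- An edge of the complete graph on vertex set Fin N, given by its two
-- endpoints (order irrelevant, see SameEdge).
Edge : ℕ → Set
Edge N = Fin N × Fin N

SameEdge : ∀ {N} → Edge N → Edge N → Set
SameEdge (a , b) (c , d) = (a ≡ c × b ≡ d) ⊎ (a ≡ d × b ≡ c)

Proper : ∀ {N} → Edge N → Set
Proper (a , b) = a ≢ b

Occurs : ∀ {N} → Edge N → List (Edge N) → Set
Occurs e es = Any (SameEdge e) es

LegalOffer : ∀ {N} → List (Edge N) → List (Edge N) → Edge N → Edge N → Set
LegalOffer red blue e f =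
  Proper e × Proper f × ¬ SameEdge e f ×
  ¬ Occurs e (red ++ blue) × ¬ Occurs f (red ++ blue)

Goal : ∀ {N} (l : ℕ) (v₁ : Fin N) → List (Edge N) → List (Edge N) → Set
Goal {N} l v₁ red blue =
  ∃ λ (w : Fin l → Fin N) →
    (∀ i j → w i ≡ w j → i ≡ j) ×
    (∀ (i : Fin l) → toℕ i ≡ 0 → w i ≡ v₁) ×
    (∀ i j → i ≢ j → Occurs (w i , w j) red) ×
    (∀ e → e ∈ red ++ blue →
       (∃ λ i → w i ≡ proj₁ e) ⊎ (∃ λ i → w i ≡ proj₂ e))

-- WaiterWins l v₁ k red blue : from the position (red, blue), Waiter has a
-- strategy that, against every Client, reaches Goal within at most k
-- further rounds.
data WaiterWins {N : ℕ} (l : ℕ) (v₁ : Fin N)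
     : ℕ → List (Edge N) → List (Edge N) → Set where
  done  : ∀ {k red blue} → Goal l v₁ red blue → WaiterWins l v₁ k red blue
  offer : ∀ {k red blue} (e f : Edge N) → LegalOffer red blue e f →
          WaiterWins l v₁ k (e ∷ red) (f ∷ blue) →
          WaiterWins l v₁ k (f ∷ red) (e ∷ blue) →
          WaiterWins l v₁ (suc k) red blue

-- Waiter grows a red clique one vertex at a time.  With K the clique so far,
-- c its next vertex and P a pool of vertices joined in red to all of K, Waiter
-- offers the edges from c to P two at a time; the ⌊|P|/2⌋ endpoints Client
-- colours red are joined in red to K and to c, so one of them becomes the next
-- vertex and the rest the next pool.  A pool of at least 2^(m+1) − 2 vertices,
-- with m vertices still to add, thus leaves one of at least 2^m − 2, starting
-- from the 2^l − 2 vertices other than v₁; the rounds number at most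
-- |P|/2 + |P|/4 + … ≤ 2^l, and every claimed edge contains a clique vertex c.

module Submission where

open import Defs
open import Data.Nat using (ℕ; zero; suc; _+_; _^_; _∸_; _≤_; ⌊_/2⌋; ⌈_/2⌉; s≤s)
open import Data.Nat.Properties
open import Data.Fin using (Fin; zero; suc; toℕ; punchIn)
open import Data.Fin.Properties using (punchInᵢ≢i; punchIn-injective)
open import Data.Fin.Permutation using (Permutation′; transpose; _⟨$⟩ʳ_; _⟨$⟩ˡ_; inverseˡ; inverseʳ)
open import Data.List using (List; []; _∷_; _++_; length; lookup; map; allFin)
open import Data.List.Properties using (length-map; length-tabulate)
open import Data.List.Relation.Unary.All as All using ([])
open import Data.List.Relation.Unary.Any using (Any; here; there; index)
open import Data.List.Relation.Unary.All.Properties using (¬Any⇒All¬)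
open import Data.List.Relation.Unary.Any.Properties using (lookup-index; ++⁺ˡ; ++⁺ʳ; ++⁻)
open import Data.List.Relation.Unary.Unique.Propositional using (Unique; []; _∷_)
open import Data.List.Relation.Unary.Unique.Propositional.Properties as Unique using (Unique[x∷xs]⇒x∉xs)
open import Data.List.Membership.Propositional using (_∈_; _∉_; find)
open import Data.List.Membership.Propositional.Properties using (∈-lookup; ∈-map⁻)
open import Data.List.Relation.Binary.Sublist.Propositional using (_⊆_; []; _∷_; _∷ʳ_; ⊆-refl; ⊆-trans)
open import Data.List.Relation.Binary.Sublist.Propositional.Properties using (All-resp-⊆; Any-resp-⊆)
open import Data.Product using (_×_; _,_; ∃; proj₁; proj₂)
open import Data.Sum as Sum using (_⊎_; inj₁; inj₂)
open import Function.Base using (case_of_)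
open import Function.Definitions using (Injective)
open import Relation.Binary.PropositionalEquality
open import Relation.Nullary using (¬_; contradiction)

Unique-resp-⊇ : ∀ {A : Set} {xs ys : List A} → xs ⊆ ys → Unique ys → Unique xs
Unique-resp-⊇ []         []       = []
Unique-resp-⊇ (y ∷ʳ τ)   (_ ∷ u)  = Unique-resp-⊇ τ u
Unique-resp-⊇ (refl ∷ τ) (p ∷ u)  = All-resp-⊆ τ p ∷ Unique-resp-⊇ τ u

Unique⇒lookup-injective : ∀ {A : Set} {xs : List A} → Unique xs → Injective _≡_ _≡_ (lookup xs)
Unique⇒lookup-injective (_ ∷ _) {zero}  {zero}  _  = refl
Unique⇒lookup-injective (p ∷ _) {zero}  {suc j} eq = contradiction eq (All.lookup p (∈-lookup j))
Unique⇒lookup-injective (p ∷ _) {suc i} {zero}  eq = contradiction (sym eq) (All.lookup p (∈-lookup i))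
Unique⇒lookup-injective (_ ∷ u) {suc i} {suc j} eq = cong suc (Unique⇒lookup-injective u eq)

enumerate-from : ∀ {A : Set} {xs : List A} {x} → Unique xs → x ∈ xs →
  ∃ λ (w : Fin (length xs) → A) →
    Injective _≡_ _≡_ w × (∀ i → toℕ i ≡ 0 → w i ≡ x) ×
    (∀ i → w i ∈ xs) × (∀ {y} → y ∈ xs → ∃ λ i → w i ≡ y)
enumerate-from {xs = xs@(_ ∷ _)} {x} u x∈xs =
  w , w-injective , starts-at-x , (λ i → ∈-lookup (π ⟨$⟩ʳ i)) , onto
  where
    π : Permutation′ (length xs)
    π = transpose zero (index x∈xs)
    w : Fin (length xs) → _
    w i = lookup xs (π ⟨$⟩ʳ i)
    w-injective : Injective _≡_ _≡_ w
    w-injective {i} {j} eq = begin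
      i                    ≡⟨ inverseˡ π {i} ⟨
      π ⟨$⟩ˡ (π ⟨$⟩ʳ i)    ≡⟨ cong (π ⟨$⟩ˡ_) (Unique⇒lookup-injective u {π ⟨$⟩ʳ i} {π ⟨$⟩ʳ j} eq) ⟩
      π ⟨$⟩ˡ (π ⟨$⟩ʳ j)    ≡⟨ inverseˡ π {j} ⟩
      j                    ∎
      where open ≡-Reasoning
    starts-at-x : ∀ i → toℕ i ≡ 0 → w i ≡ x
    starts-at-x zero _ = sym (lookup-index x∈xs)
    onto : ∀ {y} → y ∈ xs → ∃ λ i → w i ≡ y
    onto y∈xs = π ⟨$⟩ˡ index y∈xs , trans (cong (lookup xs) (inverseʳ π {index y∈xs})) (sym (lookup-index y∈xs))

Any-++-∷⁻ : ∀ {A : Set} {P : A → Set} {x y : A} xs {ys} →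
  Any P ((x ∷ xs) ++ (y ∷ ys)) → P x ⊎ P y ⊎ Any P (xs ++ ys)
Any-++-∷⁻ xs (here px) = inj₁ px
Any-++-∷⁻ xs (there p) with ++⁻ xs p
... | inj₁ p′         = inj₂ (inj₂ (++⁺ˡ p′))
... | inj₂ (here py)  = inj₂ (inj₁ py)
... | inj₂ (there p′) = inj₂ (inj₂ (++⁺ʳ xs p′))

2^suc≰1 : ∀ m → ¬ 2 ^ suc m ≤ 1
2^suc≰1 m h with ≤-trans (*-monoʳ-≤ 2 (m^n>0 2 m)) h
... | s≤s ()

2^suc≤2+n⇒2^≤1+⌊n/2⌋ : ∀ m n → 2 ^ suc m ≤ 2 + n → 2 ^ m ≤ suc ⌊ n /2⌋
2^suc≤2+n⇒2^≤1+⌊n/2⌋ m n h = begin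
  2 ^ m                  ≡⟨ n≡⌊n+n/2⌋ (2 ^ m) ⟩
  ⌊ 2 ^ m + 2 ^ m /2⌋    ≤⟨ ⌊n/2⌋-mono (subst (_≤ 2 + n) (cong (2 ^ m +_) (+-identityʳ (2 ^ m))) h) ⟩
  ⌊ 2 + n /2⌋            ∎
  where open ≤-Reasoning

module _ {N : ℕ} where

  Occurs-swap : ∀ {a b : Fin N} {es} → Occurs (a , b) es → Occurs (b , a) es
  Occurs-swap (here (inj₁ (p , q))) = here (inj₂ (q , p))
  Occurs-swap (here (inj₂ (p , q))) = here (inj₁ (q , p))
  Occurs-swap (there o)             = there (Occurs-swap o)

  Touches : List (Fin N) → List (Edge N) → Set
  Touches K es = ∀ {e} → e ∈ es → proj₁ e ∈ K ⊎ proj₂ e ∈ K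

  Occurs⇒touches : ∀ {K es} {x y : Fin N} → Touches K es → Occurs (x , y) es → x ∈ K ⊎ y ∈ K
  Occurs⇒touches touches occ with find occ
  ... | e , e∈es , inj₁ (refl , refl) = touches e∈es
  ... | e , e∈es , inj₂ (refl , refl) = Sum.swap (touches e∈es)

  clique-goal : ∀ {l} (v₁ : Fin N) {red blue} (K : List (Fin N)) → length K ≡ l →
    Unique K → v₁ ∈ K →
    (∀ {x y} → x ∈ K → y ∈ K → x ≢ y → Occurs (x , y) red) →
    Touches K (red ++ blue) → Goal l v₁ red blue
  clique-goal v₁ K refl unique v₁∈K red-clique touches
    with enumerate-from unique v₁∈K
  ... | w , w-injective , starts-at-v₁ , w∈K , onto =
    w , (λ _ _ → w-injective) , starts-at-v₁ ,
    (λ i j i≢j → red-clique (w∈K i) (w∈K j) (λ eq → i≢j (w-injective eq))) ,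
    (λ _ e∈es → Sum.map onto onto (touches e∈es))

  WaiterWins-mono : ∀ {l v₁ k k′ red blue} → k ≤ k′ →
    WaiterWins {N} l v₁ k red blue → WaiterWins l v₁ k′ red blue
  WaiterWins-mono _         (done goal)             = done goal
  WaiterWins-mono (s≤s k≤k′) (offer e f legal w₁ w₂) =
    offer e f legal (WaiterWins-mono k≤k′ w₁) (WaiterWins-mono k≤k′ w₂)

  record Extends (c : Fin N) (red blue red′ blue′ : List (Edge N)) : Set where
    field
      keeps-red : ∀ {e} → Occurs e red → Occurs e red′
      new-at-c  : ∀ {e} → e ∈ red′ ++ blue′ → e ∈ red ++ blue ⊎ proj₁ e ≡ c
  open Extends

  Extends-refl : ∀ {c red blue} → Extends c red blue red blue
  Extends-refl = record { keeps-red = λ o → o ; new-at-c = inj₁ }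

  Extends-round : ∀ {c x y red blue} → Extends c red blue ((c , x) ∷ red) ((c , y) ∷ blue)
  Extends-round {red = red} = record
    { keeps-red = there
    ; new-at-c  = λ e∈ → case Any-++-∷⁻ red e∈ of λ
        { (inj₁ refl)        → inj₂ refl
        ; (inj₂ (inj₁ refl)) → inj₂ refl
        ; (inj₂ (inj₂ old))  → inj₁ old }
    }

  Extends-trans : ∀ {c r b r′ b′ r″ b″} →
    Extends c r b r′ b′ → Extends c r′ b′ r″ b″ → Extends c r b r″ b″
  Extends-trans ext ext′ = record
    { keeps-red = λ o → keeps-red ext′ (keeps-red ext o)
    ; new-at-c  = λ e∈ → case new-at-c ext′ e∈ of λ
        { (inj₁ e∈′) → new-at-c ext e∈′
        ; (inj₂ at-c) → inj₂ at-c }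
    }

module Strategy {N : ℕ} (l : ℕ) (v₁ : Fin N) where

  open Extends

  -- A win must be guaranteed against every Client, so the phase hands each of
  -- its possible outcomes to a continuation.
  StarPhaseContinuation : Fin N → List (Fin N) → ℕ → List (Edge N) → List (Edge N) → Set
  StarPhaseContinuation c P k red blue = ∀ {R red′ blue′} → R ⊆ P → length R ≡ ⌊ length P /2⌋ →
    (∀ {r} → r ∈ R → Occurs (c , r) red′) → Extends c red blue red′ blue′ →
    WaiterWins l v₁ k red′ blue′

  star-phase : ∀ {k red blue} c P → Unique P → c ∉ P →
    (∀ {p} → p ∈ P → ¬ Occurs (c , p) (red ++ blue)) →
    StarPhaseContinuation c P k red blue → WaiterWins l v₁ (⌊ length P /2⌋ + k) red blue
  star-phase c []       _ _ _ κ = κ [] refl (λ ()) Extends-refl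
  star-phase c (x ∷ []) _ _ _ κ = κ (x ∷ʳ []) refl (λ ()) Extends-refl
  star-phase {k} {red} {blue} c (a ∷ b ∷ P) unique@(_ ∷ unique-bP@(_ ∷ unique-P)) c∉ unclaimed κ =
    offer (c , a) (c , b) (c≢a , c≢b , a,b-distinct , unclaimed (here refl) , unclaimed (there (here refl)))
      (round a b (refl ∷ (b ∷ʳ ⊆-refl)) a∉P b∉P c≢a c≢b)
      (round b a (a ∷ʳ ⊆-refl) b∉P a∉P c≢b c≢a)
    where
      a∉P : a ∉ P
      a∉P a∈P = Unique[x∷xs]⇒x∉xs unique (there a∈P)
      b∉P : b ∉ P
      b∉P b∈P = Unique[x∷xs]⇒x∉xs unique-bP b∈P
      c≢a : c ≢ a
      c≢a c≡a = c∉ (here c≡a)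
      c≢b : c ≢ b
      c≢b c≡b = c∉ (there (here c≡b))
      a,b-distinct : ¬ SameEdge (c , a) (c , b)
      a,b-distinct (inj₁ (_ , a≡b)) = Unique[x∷xs]⇒x∉xs unique (here a≡b)
      a,b-distinct (inj₂ (c≡b , _)) = c≢b c≡b
      round : ∀ x y → x ∷ P ⊆ a ∷ b ∷ P → x ∉ P → y ∉ P → c ≢ x → c ≢ y →
        WaiterWins l v₁ (⌊ length P /2⌋ + k) ((c , x) ∷ red) ((c , y) ∷ blue)
      round x y τ x∉P y∉P c≢x c≢y =
        star-phase c P unique-P (λ c∈P → c∉ (there (there c∈P))) unclaimed′ κ′
        where
          unclaimed′ : ∀ {p} → p ∈ P → ¬ Occurs (c , p) (((c , x) ∷ red) ++ ((c , y) ∷ blue))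
          unclaimed′ p∈P occ with Any-++-∷⁻ red occ
          ... | inj₁ (inj₁ (_ , refl))        = x∉P p∈P
          ... | inj₁ (inj₂ (c≡x , _))         = c≢x c≡x
          ... | inj₂ (inj₁ (inj₁ (_ , refl))) = y∉P p∈P
          ... | inj₂ (inj₁ (inj₂ (c≡y , _)))  = c≢y c≡y
          ... | inj₂ (inj₂ old)               = unclaimed (there (there p∈P)) old
          κ′ : StarPhaseContinuation c P k ((c , x) ∷ red) ((c , y) ∷ blue)
          κ′ {R} {red′} τR len joined ext =
            κ (⊆-trans (refl ∷ τR) τ) (cong suc len) joined′ (Extends-trans Extends-round ext)
            where
              joined′ : ∀ {r} → r ∈ x ∷ R → Occurs (c , r) red′
              joined′ (here refl)  = keeps-red ext (here (inj₁ (refl , refl)))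
              joined′ (there r∈R) = joined r∈R

  -- Claimed edges touch K but not c, which keeps every edge from c to P free.
  record Stage (K : List (Fin N)) (c : Fin N) (P : List (Fin N)) (red blue : List (Edge N)) : Set where
    field
      clique-unique : Unique (c ∷ K)
      pool-unique   : Unique P
      pool-fresh    : ∀ {p} → p ∈ P → p ∉ c ∷ K
      root          : v₁ ∈ c ∷ K
      clique-red    : ∀ {x y} → x ∈ c ∷ K → y ∈ c ∷ K → x ≢ y → Occurs (x , y) red
      pool-red      : ∀ {x p} → x ∈ K → p ∈ P → Occurs (x , p) red
      touches       : Touches K (red ++ blue)

  module _ {K c P red blue} (S : Stage K c P red blue) where
    open Stage S

    centre∉pool : c ∉ P
    centre∉pool c∈P = pool-fresh c∈P (here refl)

    centre-unclaimed : ∀ {p} → p ∈ P → ¬ Occurs (c , p) (red ++ blue)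
    centre-unclaimed p∈P occ with Occurs⇒touches touches occ
    ... | inj₁ c∈K = Unique[x∷xs]⇒x∉xs clique-unique c∈K
    ... | inj₂ p∈K = pool-fresh p∈P (there p∈K)

    next-stage : ∀ {c′ P′ red′ blue′} → c′ ∷ P′ ⊆ P →
      (∀ {r} → r ∈ c′ ∷ P′ → Occurs (c , r) red′) → Extends c red blue red′ blue′ →
      Stage (c ∷ K) c′ P′ red′ blue′
    next-stage {c′} {P′} {red′} τ joined ext = record
      { clique-unique = ¬Any⇒All¬ (c ∷ K) (pool-fresh (in-pool (here refl))) ∷ clique-unique
      ; pool-unique   = unique-P′
      ; pool-fresh    = λ { p∈P′ (here p≡c′)  → Unique[x∷xs]⇒x∉xs unique-R (subst (_∈ P′) p≡c′ p∈P′)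
                          ; p∈P′ (there p∈cK) → pool-fresh (in-pool (there p∈P′)) p∈cK }
      ; root          = there root
      ; clique-red    = clique-red′
      ; pool-red      = λ x∈cK p∈P′ → red-to-new x∈cK (there p∈P′)
      ; touches       = λ e∈ → case new-at-c ext e∈ of λ
          { (inj₁ old) → Sum.map there there (touches old)
          ; (inj₂ at-c) → inj₁ (here at-c) }
      }
      where
        in-pool : ∀ {r} → r ∈ c′ ∷ P′ → r ∈ P
        in-pool = Any-resp-⊆ τ
        unique-R : Unique (c′ ∷ P′)
        unique-R = Unique-resp-⊇ τ pool-unique
        unique-P′ : Unique P′
        unique-P′ with unique-R
        ... | _ ∷ u = u
        red-to-new : ∀ {x r} → x ∈ c ∷ K → r ∈ c′ ∷ P′ → Occurs (x , r) red′
        red-to-new (here refl) r∈R = joined r∈R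
        red-to-new (there x∈K) r∈R = keeps-red ext (pool-red x∈K (in-pool r∈R))
        clique-red′ : ∀ {x y} → x ∈ c′ ∷ c ∷ K → y ∈ c′ ∷ c ∷ K → x ≢ y → Occurs (x , y) red′
        clique-red′ (here refl) (here refl) x≢y = contradiction refl x≢y
        clique-red′ (here refl) (there y∈) _    = Occurs-swap (red-to-new y∈ (here refl))
        clique-red′ (there x∈) (here refl) _    = red-to-new x∈ (here refl)
        clique-red′ (there x∈) (there y∈) x≢y  = keeps-red ext (clique-red x∈ y∈ x≢y)

    finished : length (c ∷ K) ≡ l → Goal l v₁ red blue
    finished len = clique-goal v₁ (c ∷ K) len clique-unique root clique-red
      (λ e∈ → Sum.map there there (touches e∈))

  build-clique : ∀ m {K c P red blue} → length (c ∷ K) + m ≡ l → 2 ^ m ≤ suc ⌊ length P /2⌋ →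
    Stage K c P red blue → WaiterWins l v₁ (length P) red blue
  build-clique zero eq _ S = done (finished S (trans (sym (+-identityʳ _)) eq))
  build-clique (suc m) {K} {c} {P} {red} {blue} eq size S =
    subst (λ k → WaiterWins l v₁ k red blue) (⌊n/2⌋+⌈n/2⌉≡n (length P))
      (star-phase c P (Stage.pool-unique S) (centre∉pool S) (centre-unclaimed S) continue)
    where
      continue : StarPhaseContinuation c P ⌈ length P /2⌉ red blue
      continue {[]} _ len _ _ =
        contradiction (subst (λ r → 2 ^ suc m ≤ suc r) (sym len) size) (2^suc≰1 m)
      continue {c′ ∷ P′} τ len joined ext =
        WaiterWins-mono budget
          (build-clique m (trans (sym (+-suc (length (c ∷ K)) m)) eq) size′ (next-stage S τ joined ext))
        where
          size′ : 2 ^ m ≤ suc ⌊ length P′ /2⌋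
          size′ = 2^suc≤2+n⇒2^≤1+⌊n/2⌋ m (length P′) (subst (λ r → 2 ^ suc m ≤ suc r) (sym len) size)
          budget : length P′ ≤ ⌈ length P /2⌉
          budget = ≤-trans (n≤1+n _) (subst (_≤ ⌈ length P /2⌉) (sym len) (⌊n/2⌋≤⌈n/2⌉ (length P)))

others : ∀ {n} → Fin (suc n) → List (Fin (suc n))
others {n} v = map (punchIn v) (allFin n)

length-others : ∀ {n} (v : Fin (suc n)) → length (others v) ≡ n
length-others {n} v = trans (length-map (punchIn v) (allFin n)) (length-tabulate (λ i → i))

others-unique : ∀ {n} (v : Fin (suc n)) → Unique (others v)
others-unique {n} v = Unique.map⁺ (punchIn-injective v _ _) (Unique.allFin⁺ n)

∉-others : ∀ {n} (v : Fin (suc n)) → v ∉ others v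
∉-others v v∈ with ∈-map⁻ (punchIn v) v∈
... | j , _ , v≡punchIn = punchInᵢ≢i v j (sym v≡punchIn)

clique-from-root : ∀ m {N} (v : Fin N) → suc N ≡ 2 ^ suc m → WaiterWins (suc m) v (2 ^ suc m) [] []
clique-from-root m {suc n} v 2+n≡2^l = WaiterWins-mono budget (build-clique m refl size initial-stage)
  where
    open Strategy (suc m) v
    initial-stage : Stage [] v (others v) [] []
    initial-stage = record
      { clique-unique = [] ∷ []
      ; pool-unique   = others-unique v
      ; pool-fresh    = λ { p∈ (here refl) → ∉-others v p∈ }
      ; root          = here refl
      ; clique-red    = λ { (here refl) (here refl) x≢y → contradiction refl x≢y }
      ; pool-red      = λ ()
      ; touches       = λ ()
      }
    size : 2 ^ m ≤ suc ⌊ length (others v) /2⌋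
    size = subst (λ r → 2 ^ m ≤ suc ⌊ r /2⌋) (sym (length-others v))
             (2^suc≤2+n⇒2^≤1+⌊n/2⌋ m n (≤-reflexive (sym 2+n≡2^l)))
    budget : length (others v) ≤ 2 ^ suc m
    budget = subst₂ _≤_ (sym (length-others v)) 2+n≡2^l (≤-trans (n≤1+n n) (n≤1+n (suc n)))

lemma5 : (l : ℕ) → 2 ≤ l → (v₁ : Fin (2 ^ l ∸ 1)) →
    WaiterWins l v₁ (2 ^ l) [] []
lemma5 zero    _ ()
lemma5 (suc m) _ v₁ = clique-from-root m v₁ (m+[n∸m]≡n (m^n>0 2 (suc m)))
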